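{- Let ${\mathcal Q}=(W,{\preccurlyeq},S,\ell)$ be a deterministic quasimodel, and define a valuation $[\![\cdot]\!]^{\ell}$ on ${\mathcal Q}$ by setting $[\![p]\!]^\ell =\{w \in W : p \in \ell^+(w)\}$ and extending to all of $\mathcal L$ recursively. Then, for all formulas $\varphi \in \mathcal L_\Diamond$ and for all $w \in W$, (1) if $\varphi \in \ell^+(w)$ then $w \in [\![\varphi]\!]^{\ell}$, and (2) if $\varphi \in \ell^-(w)$ then $w \notin [\![\varphi]\!]^{\ell}$.
   Context: $\mathcal L_\Diamond$ is the $\Box$-free language built from propositional variables and $\bot$ by $\wedge,\vee,\to,\circ,\Diamond$. A (two-sided) type is a pair $\Phi=(\Phi^-;\Phi^+)$ of finite sets of $\mathcal L_\Diamond$-formulas with $\Phi^-\cap\Phi^+=\varnothing$, $\bot\notin\Phi^+$, and: $\varphi\wedge\psi\in\Phi^+\Rightarrow\varphi,\psi\in\Phi^+$; $\varphi\wedge\psi\in\Phi^-\Rightarrow\varphi\in\Phi^-$ or $\psi\in\Phi^-$; $\varphi\vee\psi\in\Phi^+\Rightarrow\varphi\in\Phi^+$ or $\psi\in\Phi^+$; $\varphi\vee\psi\in\Phi^-\Rightarrow\varphi,\psi\in\Phi^-$; $\varphi\to\psi\in\Phi^+\Rightarrow\varphi\in\Phi^-$ or $\psi\in\Phi^+$; $\Diamond\varphi\in\Phi^-\Rightarrow\varphi\in\Phi^-$. Write $\Phi\preccurlyeq_T\Psi$ if $\Psi^-\subseteq\Phi^-$ and $\Phi^+\subseteq\Psi^+$.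 A labelled frame $(W,\preccurlyeq,\ell)$ has $\preccurlyeq$ a partial order and $\ell$ assigning types $\ell(w)=(\ell^-(w),\ell^+(w))$ such that $w\preccurlyeq v$ implies $\ell(w)\preccurlyeq_T\ell(v)$, and whenever $\varphi\to\psi\in\ell^-(w)$ there is $v\succcurlyeq w$ with $\varphi\in\ell^+(v)$, $\psi\in\ell^-(v)$. Define $\Phi\, S_T\,\Psi$ iff: $\circ\varphi\in\Phi^+\Rightarrow\varphi\in\Psi^+$; $\circ\varphi\in\Phi^-\Rightarrow\varphi\in\Psi^-$; $\Diamond\varphi\in\Phi^+\Rightarrow\varphi\in\Phi^+$ or $\Diamond\varphi\in\Psi^+$; $\Diamond\varphi\in\Phi^-\Rightarrow\Diamond\varphi\in\Psi^-$. A quasimodel is $(W,\preccurlyeq,S,\ell)$ with $(W,\preccurlyeq,\ell)$ a labelled frame and $S\subseteq W\times W$ serial, forward-confluent (if $w\preccurlyeq w'$ and $w\,S\,v$ there is $v'\succcurlyeq v$ with $w'\,S\,v'$), sensible ($w\,S\,x$ implies $\ell(w)\,S_T\,\ell(x)$), and $\omega$-sensible (if $\Diamond\varphi\in\ell^+(w)$ there are $n\ge0$ and $v$ with $w\,S^n\,v$ and $\varphi\in\ell^+(v)$); it is deterministic if $S$ is a function (then $S$ is monotone, so $(W,\preccurlyeq,S)$ is a dynamic poset). The valuation is extended by the usual clauses on the up-set topology: $[\![\bot]\!]^\ell=\varnothing$, $\cap$ for $\wedge$, $\cup$ for $\vee$, $w\in[\![\varphi\to\psi]\!]^\ell$ iff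 for all $v\succcurlyeq w$, $v\in[\![\varphi]\!]^\ell$ implies $v\in[\![\psi]\!]^\ell$, $[\![\circ\varphi]\!]^\ell=S^{ -1}[\![\varphi]\!]^\ell$, $[\![\Diamond\varphi]\!]^\ell=\bigcup_{n\ge0}S^{ -n}[\![\varphi]\!]^\ell$. -}

module Defs where

open import Data.Nat using (ℕ; zero; suc)
open import Data.List using (List)
open import Data.List.Membership.Propositional using (_∈_)
open import Data.Product using (Σ; _×_; _,_)
open import Data.Sum using (_⊎_)
open import Data.Empty using (⊥)
open import Relation.Nullary using (¬_)
open import Relation.Binary.PropositionalEquality using (_≡_)
open import Relation.Binary.Structures using (IsPartialOrder)

data Formula : Set where
  var  : ℕ → Formula
  fls  : Formula
  _∧′_ : Formula → Formula → Formula
  _∨′_ : Formula → Formula → Formula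
  _⇒_  : Formula → Formula → Formula
  ○_   : Formula → Formula
  ◇_   : Formula → Formula

record TwoSidedType : Set where
  field
    neg pos : List Formula
    disjoint : ∀ φ → φ ∈ neg → φ ∈ pos → ⊥
    fls∉pos  : ¬ (fls ∈ pos)
    ∧-pos : ∀ φ ψ → (φ ∧′ ψ) ∈ pos → φ ∈ pos × ψ ∈ pos
    ∧-neg : ∀ φ ψ → (φ ∧′ ψ) ∈ neg → φ ∈ neg ⊎ ψ ∈ neg
    ∨-pos : ∀ φ ψ → (φ ∨′ ψ) ∈ pos → φ ∈ pos ⊎ ψ ∈ pos
    ∨-neg : ∀ φ ψ → (φ ∨′ ψ) ∈ neg → φ ∈ neg × ψ ∈ neg
    ⇒-pos : ∀ φ ψ → (φ ⇒ ψ) ∈ pos → φ ∈ neg ⊎ ψ ∈ pos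
    ◇-neg : ∀ φ → (◇ φ) ∈ neg → φ ∈ neg
open TwoSidedType public

_≼T_ : TwoSidedType → TwoSidedType → Set
Φ ≼T Ψ = (∀ φ → φ ∈ neg Ψ → φ ∈ neg Φ) × (∀ φ → φ ∈ pos Φ → φ ∈ pos Ψ)

ST : TwoSidedType → TwoSidedType → Set
ST Φ Ψ =
  (∀ φ → (○ φ) ∈ pos Φ → φ ∈ pos Ψ) ×
  (∀ φ → (○ φ) ∈ neg Φ → φ ∈ neg Ψ) ×
  (∀ φ → (◇ φ) ∈ pos Φ → φ ∈ pos Φ ⊎ (◇ φ) ∈ pos Ψ) ×
  (∀ φ → (◇ φ) ∈ neg Φ → (◇ φ) ∈ neg Ψ)

Iter : {W : Set} → (W → W → Set) → ℕ → W → W → Set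
Iter S zero    w v = w ≡ v
Iter S (suc n) w v = Σ _ λ u → S w u × Iter S n u v

record Quasimodel : Set₁ where
  field
    W   : Set
    _≼_ : W → W → Set
    S   : W → W → Set
    ℓ   : W → TwoSidedType
    ≼-po : IsPartialOrder _≡_ _≼_
    ℓ-mono : ∀ {w v} → w ≼ v → ℓ w ≼T ℓ v
    ℓ-⇒-neg : ∀ w φ ψ → (φ ⇒ ψ) ∈ neg (ℓ w) →
              Σ W λ v → w ≼ v × φ ∈ pos (ℓ v) × ψ ∈ neg (ℓ v)
    serial : ∀ w → Σ W λ v → S w v
    forward-confluent : ∀ {w w′ v} → w ≼ w′ → S w v → Σ W λ v′ → v ≼ v′ × S w′ v′
    sensible : ∀ {w x} → S w x → ST (ℓ w) (ℓ x)
    ω-sensible : ∀ w φ → (◇ φ) ∈ pos (ℓ w) →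
                 Σ ℕ λ n → Σ W λ v → Iter S n w v × φ ∈ pos (ℓ v)

Deterministic : Quasimodel → Set
Deterministic Q = ∀ w → Σ W λ v → S w v × (∀ v′ → S w v′ → v′ ≡ v)
  where open Quasimodel Q

⟦_⟧ : (Q : Quasimodel) → Formula → Quasimodel.W Q → Set
⟦ Q ⟧ (var p) w = var p ∈ pos (Quasimodel.ℓ Q w)
⟦ Q ⟧ fls w = ⊥
⟦ Q ⟧ (φ ∧′ ψ) w = ⟦ Q ⟧ φ w × ⟦ Q ⟧ ψ w
⟦ Q ⟧ (φ ∨′ ψ) w = ⟦ Q ⟧ φ w ⊎ ⟦ Q ⟧ ψ w
⟦ Q ⟧ (φ ⇒ ψ) w = ∀ v → Quasimodel._≼_ Q w v → ⟦ Q ⟧ φ v → ⟦ Q ⟧ ψ v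
⟦ Q ⟧ (○ φ) w = Σ (Quasimodel.W Q) λ v → Quasimodel.S Q w v × ⟦ Q ⟧ φ v
⟦ Q ⟧ (◇ φ) w = Σ ℕ λ n → Σ (Quasimodel.W Q) λ v → Iter (Quasimodel.S Q) n w v × ⟦ Q ⟧ φ v

module Submission where

-- The propositional cases use the closure
-- conditions of two-sided types, together with monotonicity of ℓ and the
-- ⇒-witness condition of labelled frames for implication.  The ○ case uses
-- seriality and sensibility.  The ◇ case uses ω-sensibility for the
-- positive side; for the negative side we first show that ◇φ ∈ ℓ⁻ is
-- preserved along every S-path, so φ ∈ ℓ⁻ at every Sⁿ-successor.
--
-- Since ○ is interpreted existentially, seriality already provides the
-- successor that determinism would give, so the truth lemma is proved
-- for arbitrary quasimodels.

open import Defs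
open import Data.Nat using (zero; suc)
open import Data.Product using (_×_; _,_; proj₁; proj₂)
open import Data.Sum using (inj₁; inj₂)
open import Data.Empty using (⊥-elim)
open import Data.List.Membership.Propositional using (_∈_)
open import Relation.Nullary using (¬_)
open import Relation.Binary.PropositionalEquality using (refl)

module TruthLemma (Q : Quasimodel) where
  open Quasimodel Q

  Faithful : Formula → Set
  Faithful φ = ∀ w → (φ ∈ pos (ℓ w) → ⟦ Q ⟧ φ w) × (φ ∈ neg (ℓ w) → ¬ ⟦ Q ⟧ φ w)

  ○-pos-step : ∀ {w x} φ → S w x → (○ φ) ∈ pos (ℓ w) → φ ∈ pos (ℓ x)
  ○-pos-step φ s = proj₁ (sensible s) φ

  ○-neg-step : ∀ {w x} φ → S w x → (○ φ) ∈ neg (ℓ w) → φ ∈ neg (ℓ x)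
  ○-neg-step φ s = proj₁ (proj₂ (sensible s)) φ

  ◇-neg-step : ∀ {w x} φ → S w x → (◇ φ) ∈ neg (ℓ w) → (◇ φ) ∈ neg (ℓ x)
  ◇-neg-step φ s = proj₂ (proj₂ (proj₂ (sensible s))) φ

  -- A refuted ◇φ stays refuted along any S-path, hence φ is refuted at
  -- every world reachable in finitely many steps.
  ◇-neg-along : ∀ φ n {w v} → Iter S n w v → (◇ φ) ∈ neg (ℓ w) → φ ∈ neg (ℓ v)
  ◇-neg-along φ zero    {w} refl          h = ◇-neg (ℓ w) φ h
  ◇-neg-along φ (suc n) (_ , s , path)    h = ◇-neg-along φ n path (◇-neg-step φ s h)

  var-faithful : ∀ p → Faithful (var p)
  var-faithful p w = (λ h → h) , disjoint (ℓ w) (var p)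

  fls-faithful : Faithful fls
  fls-faithful w = (λ h → ⊥-elim (fls∉pos (ℓ w) h)) , (λ _ x → x)

  ∧-faithful : ∀ {φ ψ} → Faithful φ → Faithful ψ → Faithful (φ ∧′ ψ)
  ∧-faithful {φ} {ψ} ihφ ihψ w = verified , refuted
    where
    verified : (φ ∧′ ψ) ∈ pos (ℓ w) → ⟦ Q ⟧ (φ ∧′ ψ) w
    verified h with ∧-pos (ℓ w) φ ψ h
    ... | hφ , hψ = proj₁ (ihφ w) hφ , proj₁ (ihψ w) hψ

    refuted : (φ ∧′ ψ) ∈ neg (ℓ w) → ¬ ⟦ Q ⟧ (φ ∧′ ψ) w
    refuted h (x , y) with ∧-neg (ℓ w) φ ψ h
    ... | inj₁ hφ = proj₂ (ihφ w) hφ x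
    ... | inj₂ hψ = proj₂ (ihψ w) hψ y

  ∨-faithful : ∀ {φ ψ} → Faithful φ → Faithful ψ → Faithful (φ ∨′ ψ)
  ∨-faithful {φ} {ψ} ihφ ihψ w = verified , refuted
    where
    verified : (φ ∨′ ψ) ∈ pos (ℓ w) → ⟦ Q ⟧ (φ ∨′ ψ) w
    verified h with ∨-pos (ℓ w) φ ψ h
    ... | inj₁ hφ = inj₁ (proj₁ (ihφ w) hφ)
    ... | inj₂ hψ = inj₂ (proj₁ (ihψ w) hψ)

    refuted : (φ ∨′ ψ) ∈ neg (ℓ w) → ¬ ⟦ Q ⟧ (φ ∨′ ψ) w
    refuted h (inj₁ x) = proj₂ (ihφ w) (proj₁ (∨-neg (ℓ w) φ ψ h)) x
    refuted h (inj₂ y) = proj₂ (ihψ w) (proj₂ (∨-neg (ℓ w) φ ψ h)) y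

  -- Positive: φ ⇒ ψ persists upward by monotonicity of ℓ, and at each
  -- successor either φ is refuted or ψ verified.  Negative: the frame
  -- supplies a successor verifying φ and refuting ψ.
  ⇒-faithful : ∀ {φ ψ} → Faithful φ → Faithful ψ → Faithful (φ ⇒ ψ)
  ⇒-faithful {φ} {ψ} ihφ ihψ w = verified , refuted
    where
    verified : (φ ⇒ ψ) ∈ pos (ℓ w) → ⟦ Q ⟧ (φ ⇒ ψ) w
    verified h v w≼v x with ⇒-pos (ℓ v) φ ψ (proj₂ (ℓ-mono w≼v) (φ ⇒ ψ) h)
    ... | inj₁ hφ = ⊥-elim (proj₂ (ihφ v) hφ x)
    ... | inj₂ hψ = proj₁ (ihψ v) hψ

    refuted : (φ ⇒ ψ) ∈ neg (ℓ w) → ¬ ⟦ Q ⟧ (φ ⇒ ψ) w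
    refuted h f with ℓ-⇒-neg w φ ψ h
    ... | v , w≼v , hφ , hψ = proj₂ (ihψ v) hψ (f v w≼v (proj₁ (ihφ v) hφ))

  ○-faithful : ∀ {φ} → Faithful φ → Faithful (○ φ)
  ○-faithful {φ} ih w = verified , refuted
    where
    verified : (○ φ) ∈ pos (ℓ w) → ⟦ Q ⟧ (○ φ) w
    verified h with serial w
    ... | v , s = v , s , proj₁ (ih v) (○-pos-step φ s h)

    refuted : (○ φ) ∈ neg (ℓ w) → ¬ ⟦ Q ⟧ (○ φ) w
    refuted h (v , s , x) = proj₂ (ih v) (○-neg-step φ s h) x

  ◇-faithful : ∀ {φ} → Faithful φ → Faithful (◇ φ)
  ◇-faithful {φ} ih w = verified , refuted
    where
    verified : (◇ φ) ∈ pos (ℓ w) → ⟦ Q ⟧ (◇ φ) w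
    verified h with ω-sensible w φ h
    ... | n , v , path , hφ = n , v , path , proj₁ (ih v) hφ

    refuted : (◇ φ) ∈ neg (ℓ w) → ¬ ⟦ Q ⟧ (◇ φ) w
    refuted h (n , v , path , x) = proj₂ (ih v) (◇-neg-along φ n path h) x

  truth-lemma : ∀ φ → Faithful φ
  truth-lemma (var p)  = var-faithful p
  truth-lemma fls      = fls-faithful
  truth-lemma (φ ∧′ ψ) = ∧-faithful (truth-lemma φ) (truth-lemma ψ)
  truth-lemma (φ ∨′ ψ) = ∨-faithful (truth-lemma φ) (truth-lemma ψ)
  truth-lemma (φ ⇒ ψ)  = ⇒-faithful (truth-lemma φ) (truth-lemma ψ)
  truth-lemma (○ φ)    = ○-faithful (truth-lemma φ)
  truth-lemma (◇ φ)    = ◇-faithful (truth-lemma φ)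

lemma7p6 : (Q : Quasimodel) → Deterministic Q →
    ∀ (φ : Formula) (w : Quasimodel.W Q) →
      (φ ∈ pos (Quasimodel.ℓ Q w) → ⟦ Q ⟧ φ w) ×
      (φ ∈ neg (Quasimodel.ℓ Q w) → ¬ ⟦ Q ⟧ φ w)
lemma7p6 Q _ = TruthLemma.truth-lemma Q
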